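{- Let $\mathcal B$ be a pre-matroid on a finite set $X$ and let $\omega,\pi,a,z,\varepsilon$ be as in the context. Suppose $Q$ is a non-branching almost-basis of $\mathcal B$ and $\varphi(Q)=Q+d$. If $\varepsilon(Q+d)\ne Q+d$ and $\varepsilon(Q+d)\in\mathcal B$, then $d\ne a$ and $d\ne z$.
   Context: A pre-matroid on a finite set $X$ is a non-empty set $\mathcal B$ of subsets of $X$ (bases). For $Y\subseteq X$, $x\notin Y$, $Y+x=Y\cup\{x\}$; for $y\in Y$, $Y-y=Y\setminus\{y\}$. An almost-basis is $B-x$ with $B\in\mathcal B$, $x\in B$; $U(D)=\{x\notin D: D+x\in\mathcal B\}$. For a linear order $\rho$ on $X$ and an almost-basis $D$, $\varphi_\rho(D)=D+\min_\rho U(D)$. Let $\omega$ be a linear order on $X$, $a\ne z$ consecutive for $\omega$ with $a<_\omega z$, $\varepsilon$ the transposition exchanging $a,z$ (acting on subsets elementwise), and $\pi$ the linear order agreeing with $\omega$ except $z<_\pi a$. An almost-basis $D$ is non-branching if $\varphi_\omega(D)=\varphi_\pi(D)$, and then $\varphi(D)$ denotes this common value. -}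

module Defs where

open import Level using (0ℓ)
open import Data.Nat using (ℕ)
open import Data.Fin using (Fin; _≟_)
open import Data.Fin.Subset using (Subset; _∈_; _∉_; inside; outside)
open import Data.Vec using (tabulate; lookup; _[_]≔_)
open import Data.Product using (_×_; ∃; Σ)
open import Data.Sum using (_⊎_)
open import Relation.Binary using (Rel; IsStrictTotalOrder)
open import Relation.Binary.PropositionalEquality using (_≡_; _≢_)
open import Relation.Nullary using (¬_; yes; no)

-- The ground set X is Fin n.  A pre-matroid is a non-empty set of subsets.
-- Sets of subsets are predicates on Subset n.
IsPreMatroid : {n : ℕ} → (Subset n → Set) → Set
IsPreMatroid 𝓑 = ∃ λ B → 𝓑 B

_+ₛ_ : {n : ℕ} → Subset n → Fin n → Subset n
Y +ₛ x = Y [ x ]≔ inside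

_-ₛ_ : {n : ℕ} → Subset n → Fin n → Subset n
Y -ₛ y = Y [ y ]≔ outside

AlmostBasis : {n : ℕ} → (Subset n → Set) → Subset n → Set
AlmostBasis 𝓑 D = ∃ λ B → ∃ λ x → 𝓑 B × x ∈ B × D ≡ B -ₛ x

U : {n : ℕ} → (Subset n → Set) → Subset n → Fin n → Set
U 𝓑 D x = x ∉ D × 𝓑 (D +ₛ x)

-- Linear orders are given as strict total orders (x <ρ y).
-- x is the ρ-minimum of the set P
IsMin : {n : ℕ} → Rel (Fin n) 0ℓ → (Fin n → Set) → Fin n → Set
IsMin ρ P x = P x × (∀ y → P y → y ≢ x → ρ x y)

-- φ_ρ(D) = S   (relational form: S = D + min_ρ U(D))
Phi : {n : ℕ} → Rel (Fin n) 0ℓ → (Subset n → Set) → Subset n → Subset n → Set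
Phi ρ 𝓑 D S = ∃ λ x → IsMin ρ (U 𝓑 D) x × S ≡ D +ₛ x

Consecutive : {n : ℕ} → Rel (Fin n) 0ℓ → Fin n → Fin n → Set
Consecutive ω a z = ω a z × (∀ c → ¬ (ω a c × ω c z))

swapOrder : {n : ℕ} → Rel (Fin n) 0ℓ → Fin n → Fin n → Rel (Fin n) 0ℓ
swapOrder ω a z x y = (x ≡ z × y ≡ a) ⊎ (¬ (x ≡ a × y ≡ z) × ω x y)

swap : {n : ℕ} → Fin n → Fin n → Fin n → Fin n
swap a z x with x ≟ a
... | yes _ = z
... | no _ with x ≟ z
...   | yes _ = a
...   | no _ = x

-- ε acting on subsets elementwise: ε(S) = { ε(s) : s ∈ S };
-- since ε is an involution, i ∈ ε(S) iff ε(i) ∈ S.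
εₛ : {n : ℕ} → Fin n → Fin n → Subset n → Subset n
εₛ a z S = tabulate (λ i → lookup S (swap a z i))

NonBranching : {n : ℕ} → Rel (Fin n) 0ℓ → Rel (Fin n) 0ℓ → (Subset n → Set) → Subset n → Set
NonBranching ω π 𝓑 D = ∃ λ S → Phi ω 𝓑 D S × Phi π 𝓑 D S

-- If d were a, then ε(Q+a) is either Q+a (when z ∈ Q) or Q+z (when z ∉ Q); the first is
-- excluded, so z ∈ U(Q), and z <π a contradicts that non-branching makes a the π-minimum
-- of U(Q) as well.  If d were z, the same dichotomy puts a ∈ U(Q), and a <ω z contradicts
-- the ω-minimality of z.
module Submission where

open import Defs
open import Level using (0ℓ)
open import Data.Nat using (ℕ)
open import Data.Fin using (Fin; _≟_)
open import Data.Fin.Subset using (Subset; _∈_; _∉_; inside; outside)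
open import Data.Fin.Subset.Properties using (_∈?_)
open import Data.Product using (_×_; _,_; proj₂)
open import Data.Sum using (inj₁; inj₂)
open import Data.Vec using (lookup; tabulate)
open import Data.Vec.Properties
  using (lookup∘update; lookup∘update′; lookup∘tabulate; tabulate∘lookup; tabulate-cong;
         []=⇒lookup; lookup⇒[]=)
open import Function using (_∘_)
open import Relation.Binary using (Rel; IsStrictTotalOrder; Asymmetric)
open import Relation.Binary.PropositionalEquality
  using (_≡_; _≢_; refl; sym; trans; cong; subst; module ≡-Reasoning)
open import Relation.Nullary using (¬_; Dec; yes; no; contradiction)

private
  variable
    n : ℕ
    a z x y : Fin n
    p q : Subset n

lookup-ext : (∀ i → lookup p i ≡ lookup q i) → p ≡ q
lookup-ext {p = p} {q} p≗q = begin
  p                    ≡⟨ sym (tabulate∘lookup p) ⟩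
  tabulate (lookup p)  ≡⟨ tabulate-cong p≗q ⟩
  tabulate (lookup q)  ≡⟨ tabulate∘lookup q ⟩
  q                    ∎
  where open ≡-Reasoning

∉⇒lookup≡outside : x ∉ p → lookup p x ≡ outside
∉⇒lookup≡outside {x = x} {p} x∉p with lookup p x in eq
... | outside = refl
... | inside  = contradiction (lookup⇒[]= x p eq) x∉p

+ₛ-injective : x ∉ p → p +ₛ x ≡ p +ₛ y → x ≡ y
+ₛ-injective {x = x} {p} {y} x∉p eq with x ≟ y
... | yes x≡y = x≡y
... | no  x≢y = contradiction inside≡outside λ ()
  where
  open ≡-Reasoning
  inside≡outside : inside ≡ outside
  inside≡outside = begin
    inside               ≡⟨ sym (lookup∘update x p inside) ⟩
    lookup (p +ₛ x) x    ≡⟨ cong (λ r → lookup r x) eq ⟩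
    lookup (p +ₛ y) x    ≡⟨ lookup∘update′ x≢y p inside ⟩
    lookup p x           ≡⟨ ∉⇒lookup≡outside x∉p ⟩
    outside              ∎

swap-left : (a z : Fin n) → swap a z a ≡ z
swap-left a z with a ≟ a
... | yes _   = refl
... | no  a≢a = contradiction refl a≢a

swap-right : a ≢ z → swap a z z ≡ a
swap-right {a = a} {z} a≢z with z ≟ a
... | yes z≡a = contradiction (sym z≡a) a≢z
... | no  _ with z ≟ z
...   | yes _   = refl
...   | no  z≢z = contradiction refl z≢z

swap-other : x ≢ a → x ≢ z → swap a z x ≡ x
swap-other {x = x} {a} {z} x≢a x≢z with x ≟ a
... | yes x≡a = contradiction x≡a x≢a
... | no  _ with x ≟ z
...   | yes x≡z = contradiction x≡z x≢z
...   | no  _   = refl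

swap-sym : a ≢ z → ∀ x → swap a z x ≡ swap z a x
swap-sym {a = a} {z} a≢z x = by-cases (x ≟ a) (x ≟ z)
  where
  by-cases : Dec (x ≡ a) → Dec (x ≡ z) → swap a z x ≡ swap z a x
  by-cases (yes refl) _          = trans (swap-left x z) (sym (swap-right (a≢z ∘ sym)))
  by-cases (no _)     (yes refl) = trans (swap-right a≢z) (sym (swap-left x a))
  by-cases (no x≢a)   (no x≢z)   = trans (swap-other x≢a x≢z) (sym (swap-other x≢z x≢a))

εₛ-sym : a ≢ z → ∀ p → εₛ a z p ≡ εₛ z a p
εₛ-sym a≢z p = tabulate-cong (cong (lookup p) ∘ swap-sym a≢z)

lookup-εₛ : ∀ a z p (i : Fin n) → lookup (εₛ a z p) i ≡ lookup p (swap a z i)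
lookup-εₛ a z p = lookup∘tabulate (lookup p ∘ swap a z)

εₛ-+ₛ-left-of-∈ : a ≢ z → z ∈ p → εₛ a z (p +ₛ a) ≡ p +ₛ a
εₛ-+ₛ-left-of-∈ {a = a} {z} {p} a≢z z∈p =
  lookup-ext λ i → trans (lookup-εₛ a z (p +ₛ a) i) (by-cases i (i ≟ a) (i ≟ z))
  where
  z∈p+a : lookup (p +ₛ a) z ≡ inside
  z∈p+a = trans (lookup∘update′ (a≢z ∘ sym) p inside) ([]=⇒lookup z∈p)
  by-cases : ∀ i → Dec (i ≡ a) → Dec (i ≡ z) → lookup (p +ₛ a) (swap a z i) ≡ lookup (p +ₛ a) i
  by-cases i (yes refl) _          =
    trans (cong (lookup (p +ₛ i)) (swap-left i z)) (trans z∈p+a (sym (lookup∘update i p inside)))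
  by-cases i (no _)     (yes refl) =
    trans (cong (lookup (p +ₛ a)) (swap-right a≢z)) (trans (lookup∘update a p inside) (sym z∈p+a))
  by-cases i (no i≢a)   (no i≢z)   = cong (lookup (p +ₛ a)) (swap-other i≢a i≢z)

εₛ-+ₛ-left-of-∉ : a ≢ z → a ∉ p → z ∉ p → εₛ a z (p +ₛ a) ≡ p +ₛ z
εₛ-+ₛ-left-of-∉ {a = a} {z} {p} a≢z a∉p z∉p =
  lookup-ext λ i → trans (lookup-εₛ a z (p +ₛ a) i) (by-cases i (i ≟ a) (i ≟ z))
  where
  by-cases : ∀ i → Dec (i ≡ a) → Dec (i ≡ z) → lookup (p +ₛ a) (swap a z i) ≡ lookup (p +ₛ z) i
  by-cases i (yes refl) _          = begin
    lookup (p +ₛ i) (swap i z i)  ≡⟨ cong (lookup (p +ₛ i)) (swap-left i z) ⟩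
    lookup (p +ₛ i) z             ≡⟨ lookup∘update′ (a≢z ∘ sym) p inside ⟩
    lookup p z                    ≡⟨ ∉⇒lookup≡outside z∉p ⟩
    outside                       ≡⟨ ∉⇒lookup≡outside a∉p ⟨
    lookup p i                    ≡⟨ lookup∘update′ a≢z p inside ⟨
    lookup (p +ₛ z) i             ∎
    where open ≡-Reasoning
  by-cases i (no _)     (yes refl) = begin
    lookup (p +ₛ a) (swap a i i)  ≡⟨ cong (lookup (p +ₛ a)) (swap-right a≢z) ⟩
    lookup (p +ₛ a) a             ≡⟨ lookup∘update a p inside ⟩
    inside                        ≡⟨ lookup∘update i p inside ⟨
    lookup (p +ₛ i) i             ∎
    where open ≡-Reasoning
  by-cases i (no i≢a)   (no i≢z)   = begin
    lookup (p +ₛ a) (swap a z i)  ≡⟨ cong (lookup (p +ₛ a)) (swap-other i≢a i≢z) ⟩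
    lookup (p +ₛ a) i             ≡⟨ lookup∘update′ i≢a p inside ⟩
    lookup p i                    ≡⟨ lookup∘update′ i≢z p inside ⟨
    lookup (p +ₛ z) i             ∎
    where open ≡-Reasoning

εₛ-+ₛ-basis⇒U : {𝓑 : Subset n → Set} → a ≢ z → a ∉ p →
  εₛ a z (p +ₛ a) ≢ p +ₛ a → 𝓑 (εₛ a z (p +ₛ a)) → U 𝓑 p z
εₛ-+ₛ-basis⇒U {z = z} {p} {𝓑} a≢z a∉p moved basis with z ∈? p
... | yes z∈p = contradiction (εₛ-+ₛ-left-of-∈ a≢z z∈p) moved
... | no  z∉p = z∉p , subst 𝓑 (εₛ-+ₛ-left-of-∉ a≢z a∉p z∉p) basis

IsMin-unique : {ρ : Rel (Fin n) 0ℓ} {P : Fin n → Set} →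
  Asymmetric ρ → IsMin ρ P x → IsMin ρ P y → x ≡ y
IsMin-unique {x = x} {y} asym (Px , x-min) (Py , y-min) with x ≟ y
... | yes x≡y = x≡y
... | no  x≢y = contradiction (y-min x Px x≢y) (asym (x-min y Py (x≢y ∘ sym)))

Phi-+ₛ⇒IsMin : {ρ : Rel (Fin n) 0ℓ} {𝓑 : Subset n → Set} →
  x ∉ p → Phi ρ 𝓑 p (p +ₛ x) → IsMin ρ (U 𝓑 p) x
Phi-+ₛ⇒IsMin x∉p (y , y-min , eq) rewrite +ₛ-injective x∉p eq = y-min

NonBranching⇒IsMin : {ω π : Rel (Fin n) 0ℓ} {𝓑 : Subset n → Set} →
  Asymmetric ω → x ∉ p → NonBranching ω π 𝓑 p →
  IsMin ω (U 𝓑 p) x → IsMin π (U 𝓑 p) x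
NonBranching⇒IsMin {p = p} {π = π} {𝓑} asym x∉p (_ , (_ , ω-min , S≡p+y) , π-Phi) x-min
  rewrite IsMin-unique asym ω-min x-min =
    Phi-+ₛ⇒IsMin {𝓑 = 𝓑} x∉p (subst (Phi π 𝓑 p) S≡p+y π-Phi)

swapOrder-reverses : {ω : Rel (Fin n) 0ℓ} → a ≢ z → ¬ swapOrder ω a z a z
swapOrder-reverses a≢z (inj₁ (a≡z , _)) = a≢z a≡z
swapOrder-reverses a≢z (inj₂ (not-a-z , _)) = not-a-z (refl , refl)

lemma8p3 : {n : ℕ} (𝓑 : Subset n → Set) → IsPreMatroid 𝓑 →
    (ω : Rel (Fin n) 0ℓ) → IsStrictTotalOrder _≡_ ω →
    (a z : Fin n) → a ≢ z → Consecutive ω a z →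
    (Q : Subset n) (d : Fin n) → AlmostBasis 𝓑 Q → d ∉ Q →
    NonBranching ω (swapOrder ω a z) 𝓑 Q →
    Phi ω 𝓑 Q (Q +ₛ d) →
    εₛ a z (Q +ₛ d) ≢ Q +ₛ d →
    𝓑 (εₛ a z (Q +ₛ d)) →
    d ≢ a × d ≢ z
lemma8p3 𝓑 _ ω sto a z a≢z (a<z , _) Q d _ d∉Q nonBranching φQ moved basis = d≢a , d≢z
  where
  open IsStrictTotalOrder sto using (asym)
  ω-min : IsMin ω (U 𝓑 Q) d
  ω-min = Phi-+ₛ⇒IsMin {𝓑 = 𝓑} d∉Q φQ
  π-min : IsMin (swapOrder ω a z) (U 𝓑 Q) d
  π-min = NonBranching⇒IsMin {𝓑 = 𝓑} asym d∉Q nonBranching ω-min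
  d≢a : d ≢ a
  d≢a refl = swapOrder-reverses {ω = ω} a≢z (proj₂ π-min z z∈U (a≢z ∘ sym))
    where
    z∈U : U 𝓑 Q z
    z∈U = εₛ-+ₛ-basis⇒U {𝓑 = 𝓑} a≢z d∉Q moved basis
  d≢z : d ≢ z
  d≢z refl = asym a<z (proj₂ ω-min a a∈U a≢z)
    where
    a∈U : U 𝓑 Q a
    a∈U = εₛ-+ₛ-basis⇒U {𝓑 = 𝓑} (a≢z ∘ sym) d∉Q
            (subst (λ T → T ≢ Q +ₛ d) (εₛ-sym a≢z (Q +ₛ d)) moved)
            (subst 𝓑 (εₛ-sym a≢z (Q +ₛ d)) basis)
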